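{- If $P\in\mathrm{AW}\pi^E$ and $\delta\vdash P\xrightarrow{\overline{b}(c)}P'$ (a bound output transition), then $c\notin\mathrm{fn}(P')$.
   Context: The calculus AW$\pi$. Names: besides success names, each name is an I-name (only input subject) or an O-name (only output subject). Values $v ::= a \mid \star$. Processes: $P ::= 0 \mid P \mid Q \mid a(x).P \mid \overline{b}\langle v\rangle \mid (\nu\, a \leftrightarrow b)P \mid\ !a(x).P$; input and restriction bind; in $(\nu\, a\leftrightarrow b)P$, $a$ is an I-name and $b$ an O-name, called companions; $\breve c$ is the companion of bound name $c$ and $(\nu c)$ abbreviates $(\nu\,c\leftrightarrow\breve c)$ or $(\nu\,\breve c\leftrightarrow c)$ according to polarity; $\overline{a}(c):P$ stands for $(\nu c)(\overline{a}\langle c\rangle\mid P)$. Processes are simply typed with types $T::=o\,T\mid i\,T\mid\mathsf{unit}$, the typing ensuring each I-name is owned by at most one parallel component and no free I-name occurs in the body of a replication except its formal parameter. Wires: for I-name $a$ and O-name $b$, $[a\to b]:=!a(x).\overline{b}\langle x\rangle$; $[p\leftrightarrow q]$ is whichever orientation has an I-name as source. Translation $\mathcal{T}$: homomorphic on $0$, $|$, input, replicated input, restriction; $\mathcal{T}(\overline{a}\langle b\rangle)=\overline{a}(c):\mathcal{T}([\breve c\leftrightarrow b])$ with $c,\breve c$ fresh, $c$ of the polarity and type of $b$ (outputs of $\star$ unchanged). $\mathrm{AW}\pi^E$ is the set of processes generated by $P::=0\mid a(x).P\mid\mathcal{T}(\overline{a}\langle b\rangle)\mid P\mid P\mid(\nu\,a\leftrightarrow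 b)P\mid\ !a(x).P$ (the image of $\mathcal{T}$). Labelled transitions, parametrised by a connection set $\delta$ (finite set of pairs $a\leftrightarrow b$, $a$ an I-name, $b$ an O-name), written $\delta\vdash P\xrightarrow{\mu}P'$, with actions $\mu$: $\tau$, input $a(x)$, free output $\overline{a}\langle b\rangle$, bound output $\overline{a}(c)$ (meaning $c$ is exported with its companion restricted). Rules: $\delta\vdash a(x).P\xrightarrow{a(x)}P$; $\delta\vdash\ !a(x).P\xrightarrow{a(x)}P\mid\ !a(x).P$; $\delta\vdash\overline{a}\langle b\rangle\xrightarrow{\overline{a}\langle b\rangle}0$; if $\delta\vdash P\xrightarrow{\mu}P'$ then $\delta\vdash P\mid Q\xrightarrow{\mu}P'\mid Q$ (bound names of $\mu$ fresh for $Q$), and symmetrically; if $\delta\vdash P\xrightarrow{a(x)}P'$, $\delta\vdash Q\xrightarrow{\overline{b}\langle c\rangle}Q'$ and $a\leftrightarrow b\in\delta$ then $\delta\vdash P\mid Q\xrightarrow{\tau}P'\{c/x\}\mid Q'$; if $\delta\vdash P\xrightarrow{a(x)}P'$, $\delta\vdash Q\xrightarrow{\overline{b}(c)}Q'$ and $a\leftrightarrow b\in\delta$ then $\delta\vdash P\mid Q\xrightarrow{\tau}(\nu c)(P'\{c/x\}\mid Q')$ (and symmetric versions); if $\delta,(b\text{ connected to }\breve b)\vdash P\xrightarrow{\mu}P'$ and $b,\breve b\notin\mathrm{fn}(\mu)$ then $\delta\vdash(\nu b)P\xrightarrow{\mu}(\nu b)P'$; if $\delta,(b\text{ connected to }\breve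 b)\vdash P\xrightarrow{\overline{c}\langle b\rangle}P'$ then $\delta\vdash(\nu b)P\xrightarrow{\overline{c}(b)}P'$. -}

module Defs where

-- A name of type  i T  is an I-name, a name of type  o T  an O-name
-- (polarity = outer type constructor); variables of type unit stand for ⋆.

open import Data.List using (List; []; _∷_; _++_; map)
open import Data.List.Membership.Propositional using (_∈_)
open import Data.Product using (Σ; _×_; _,_)

data Ty : Set where
  unit : Ty
  o    : Ty → Ty
  i    : Ty → Ty

Ctx : Set
Ctx = List Ty

infix 4 _∋_
data _∋_ : Ctx → Ty → Set where
  zero : ∀ {Γ T} → (T ∷ Γ) ∋ T
  suc  : ∀ {Γ T S} → Γ ∋ T → (S ∷ Γ) ∋ T

data Val (Γ : Ctx) : Ty → Set where
  var : ∀ {T} → Γ ∋ T → Val Γ T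
  ⋆   : Val Γ unit

-- processes.  ν T P  is (ν a ↔ b) P with a = index 0 (I-name, type i T)
-- and b = index 1 (O-name, type o T), its companion.
infixr 5 _∥_
data Proc (Γ : Ctx) : Set where
  𝟘   : Proc Γ
  _∥_ : Proc Γ → Proc Γ → Proc Γ
  inp : ∀ {T} → Γ ∋ i T → Proc (T ∷ Γ) → Proc Γ
  out : ∀ {T} → Γ ∋ o T → Val Γ T → Proc Γ
  ν   : (T : Ty) → Proc (i T ∷ o T ∷ Γ) → Proc Γ
  rep : ∀ {T} → Γ ∋ i T → Proc (T ∷ Γ) → Proc Γ

Ren : Ctx → Ctx → Set
Ren Γ Δ = ∀ {T} → Γ ∋ T → Δ ∋ T

ext : ∀ {Γ Δ S} → Ren Γ Δ → Ren (S ∷ Γ) (S ∷ Δ)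
ext ρ zero    = zero
ext ρ (suc x) = suc (ρ x)

renV : ∀ {Γ Δ T} → Ren Γ Δ → Val Γ T → Val Δ T
renV ρ (var x) = var (ρ x)
renV ρ ⋆       = ⋆

ren : ∀ {Γ Δ} → Ren Γ Δ → Proc Γ → Proc Δ
ren ρ 𝟘         = 𝟘
ren ρ (P ∥ Q)   = ren ρ P ∥ ren ρ Q
ren ρ (inp a P) = inp (ρ a) (ren (ext ρ) P)
ren ρ (out a v) = out (ρ a) (renV ρ v)
ren ρ (ν T P)   = ν T (ren (ext (ext ρ)) P)
ren ρ (rep a P) = rep (ρ a) (ren (ext ρ) P)

Sub : Ctx → Ctx → Set
Sub Γ Δ = ∀ {T} → Γ ∋ T → Val Δ T

extS : ∀ {Γ Δ S} → Sub Γ Δ → Sub (S ∷ Γ) (S ∷ Δ)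
extS σ zero    = var zero
extS σ (suc x) = renV suc (σ x)

chanI : ∀ {Γ T} → Val Γ (i T) → Γ ∋ i T
chanI (var x) = x

chanO : ∀ {Γ T} → Val Γ (o T) → Γ ∋ o T
chanO (var x) = x

subV : ∀ {Γ Δ T} → Sub Γ Δ → Val Γ T → Val Δ T
subV σ (var x) = σ x
subV σ ⋆       = ⋆

sub : ∀ {Γ Δ} → Sub Γ Δ → Proc Γ → Proc Δ
sub σ 𝟘         = 𝟘
sub σ (P ∥ Q)   = sub σ P ∥ sub σ Q
sub σ (inp a P) = inp (chanI (σ a)) (sub (extS σ) P)
sub σ (out a v) = out (chanO (σ a)) (subV σ v)
sub σ (ν T P)   = ν T (sub (extS (extS σ)) P)
sub σ (rep a P) = rep (chanI (σ a)) (sub (extS σ) P)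

single : ∀ {Γ T} → Val Γ T → Sub (T ∷ Γ) Γ
single v zero    = v
single v (suc x) = var x

_[_] : ∀ {Γ T} → Proc (T ∷ Γ) → Val Γ T → Proc Γ
P [ v ] = sub (single v) P

wk* : ∀ {Γ} (Δ : Ctx) → Ren Γ (Δ ++ Γ)
wk* []      x = x
wk* (_ ∷ Δ) x = suc (wk* Δ x)

wk2 : ∀ {Γ A B} → Ren Γ (A ∷ B ∷ Γ)
wk2 x = suc (suc x)

swapR : ∀ {Γ A B} (Δ : Ctx) → Ren (Δ ++ (A ∷ B ∷ Γ)) (A ∷ B ∷ (Δ ++ Γ))
swapR []      x       = x
swapR (C ∷ Δ) zero    = suc (suc zero)
swapR (C ∷ Δ) (suc x) = ext (ext suc) (swapR Δ x)

infix 4 _∈fn_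
data _∈fn_ {Γ : Ctx} : ∀ {T} → Γ ∋ T → Proc Γ → Set where
  fn-parL  : ∀ {T} {x : Γ ∋ T} {P Q} → x ∈fn P → x ∈fn (P ∥ Q)
  fn-parR  : ∀ {T} {x : Γ ∋ T} {P Q} → x ∈fn Q → x ∈fn (P ∥ Q)
  fn-inpS  : ∀ {T} {a : Γ ∋ i T} {P} → a ∈fn inp a P
  fn-inpB  : ∀ {T S} {x : Γ ∋ T} {a : Γ ∋ i S} {P} → suc x ∈fn P → x ∈fn inp a P
  fn-outS  : ∀ {T} {a : Γ ∋ o T} {v} → a ∈fn out a v
  fn-outO  : ∀ {T} {a : Γ ∋ o T} {x : Γ ∋ T} → x ∈fn out a (var x)
  fn-res   : ∀ {T S} {x : Γ ∋ T} {P} → suc (suc x) ∈fn P → x ∈fn ν S P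
  fn-repS  : ∀ {T} {a : Γ ∋ i T} {P} → a ∈fn rep a P
  fn-repB  : ∀ {T S} {x : Γ ∋ T} {a : Γ ∋ i S} {P} → suc x ∈fn P → x ∈fn rep a P

-- T(a⟨b⟩) = a(c):T([c̆ ↔ b]),  c fresh of the polarity and type of b;
-- outputs of unit values unchanged.
trOut : ∀ {Γ T} → Γ ∋ o T → Val Γ T → Proc Γ
trOut {T = unit}  a v       = out a v
-- b an I-name: c = index 0 (i U), c̆ = index 1 (o U);  [c̆ ↔ b] = [b → c̆] = !b(x).c̆⟨x⟩
trOut {T = i U}   a (var b) =
  ν U (out (wk2 a) (var zero) ∥ rep (wk2 b) (trOut (suc (suc zero)) (var zero)))
-- b an O-name: c = index 1 (o U), c̆ = index 0 (i U);  [c̆ ↔ b] = [c̆ → b] = !c̆(x).b⟨x⟩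
trOut {T = o U}   a (var b) =
  ν U (out (wk2 a) (var (suc zero)) ∥ rep zero (trOut (suc (wk2 b)) (var zero)))

data AWE {Γ : Ctx} : Proc Γ → Set where
  awe-0   : AWE 𝟘
  awe-inp : ∀ {T} {a : Γ ∋ i T} {P} → AWE P → AWE (inp a P)
  awe-out : ∀ {T} {a : Γ ∋ o T} {v} → AWE (trOut a v)
  awe-par : ∀ {P Q} → AWE P → AWE Q → AWE (P ∥ Q)
  awe-res : ∀ {T P} → AWE P → AWE (ν T P)
  awe-rep : ∀ {T} {a : Γ ∋ i T} {P} → AWE P → AWE (rep a P)

Conn : Ctx → Set
Conn Γ = List (Σ Ty λ T → Γ ∋ i T × Γ ∋ o T)

renConn : ∀ {Γ Δ} → Ren Γ Δ → Conn Γ → Conn Δ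
renConn ρ = map (λ { (T , a , b) → (T , ρ a , ρ b) })

-- Label Γ Δ : an action whose bound names are Δ (the continuation lives in Δ ++ Γ)
data Label (Γ : Ctx) : Ctx → Set where
  τ     : Label Γ []
  inpL  : ∀ {T} → Γ ∋ i T → Label Γ (T ∷ [])
  fout  : ∀ {T} → Γ ∋ o T → Val Γ T → Label Γ []
  boutI : ∀ {U} → Γ ∋ o (i U) → Label Γ (i U ∷ o U ∷ [])  -- a(c), c = index 0 (I-name)
  boutO : ∀ {U} → Γ ∋ o (o U) → Label Γ (i U ∷ o U ∷ [])  -- a(c), c = index 1 (O-name)

renL : ∀ {Γ Γ' Δ} → Ren Γ Γ' → Label Γ Δ → Label Γ' Δ
renL ρ τ         = τ
renL ρ (inpL a)  = inpL (ρ a)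
renL ρ (fout a v) = fout (ρ a) (renV ρ v)
renL ρ (boutI a) = boutI (ρ a)
renL ρ (boutO a) = boutO (ρ a)

-- substitutions used when a bound output meets an input
σI : ∀ {Γ U} → Sub (i U ∷ Γ) (i U ∷ o U ∷ Γ)
σI zero    = var zero
σI (suc x) = var (suc (suc x))

σO : ∀ {Γ U} → Sub (o U ∷ Γ) (i U ∷ o U ∷ Γ)
σO zero    = var (suc zero)
σO (suc x) = var (suc (suc x))

_,νc : ∀ {Γ T} → Conn Γ → Conn (i T ∷ o T ∷ Γ)
_,νc {T = T} δ = (T , zero , suc zero) ∷ renConn wk2 δ

infix 3 _⊢_—[_]→_
data _⊢_—[_]→_ : ∀ {Γ Δ} → Conn Γ → Proc Γ → Label Γ Δ → Proc (Δ ++ Γ) → Set where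
  t-inp   : ∀ {Γ T δ} {a : Γ ∋ i T} {P} → δ ⊢ inp a P —[ inpL a ]→ P
  t-rep   : ∀ {Γ T δ} {a : Γ ∋ i T} {P} →
            δ ⊢ rep a P —[ inpL a ]→ (P ∥ ren suc (rep a P))
  t-out   : ∀ {Γ T δ} {a : Γ ∋ o T} {v} → δ ⊢ out a v —[ fout a v ]→ 𝟘
  t-parL  : ∀ {Γ Δ δ P Q} {μ : Label Γ Δ} {P'} →
            δ ⊢ P —[ μ ]→ P' → δ ⊢ P ∥ Q —[ μ ]→ (P' ∥ ren (wk* Δ) Q)
  t-parR  : ∀ {Γ Δ δ P Q} {μ : Label Γ Δ} {Q'} →
            δ ⊢ Q —[ μ ]→ Q' → δ ⊢ P ∥ Q —[ μ ]→ (ren (wk* Δ) P ∥ Q')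
  t-comL  : ∀ {Γ T δ P Q P' Q'} {a : Γ ∋ i T} {b : Γ ∋ o T} {v : Val Γ T} →
            δ ⊢ P —[ inpL a ]→ P' → δ ⊢ Q —[ fout b v ]→ Q' → (T , a , b) ∈ δ →
            δ ⊢ P ∥ Q —[ τ ]→ (P' [ v ] ∥ Q')
  t-comR  : ∀ {Γ T δ P Q P' Q'} {a : Γ ∋ i T} {b : Γ ∋ o T} {v : Val Γ T} →
            δ ⊢ P —[ fout b v ]→ P' → δ ⊢ Q —[ inpL a ]→ Q' → (T , a , b) ∈ δ →
            δ ⊢ P ∥ Q —[ τ ]→ (P' ∥ Q' [ v ])
  t-bcomLI : ∀ {Γ U δ P Q P' Q'} {a : Γ ∋ i (i U)} {b : Γ ∋ o (i U)} →
            δ ⊢ P —[ inpL a ]→ P' → δ ⊢ Q —[ boutI b ]→ Q' → (i U , a , b) ∈ δ →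
            δ ⊢ P ∥ Q —[ τ ]→ ν U (sub σI P' ∥ Q')
  t-bcomLO : ∀ {Γ U δ P Q P' Q'} {a : Γ ∋ i (o U)} {b : Γ ∋ o (o U)} →
            δ ⊢ P —[ inpL a ]→ P' → δ ⊢ Q —[ boutO b ]→ Q' → (o U , a , b) ∈ δ →
            δ ⊢ P ∥ Q —[ τ ]→ ν U (sub σO P' ∥ Q')
  t-bcomRI : ∀ {Γ U δ P Q P' Q'} {a : Γ ∋ i (i U)} {b : Γ ∋ o (i U)} →
            δ ⊢ P —[ boutI b ]→ P' → δ ⊢ Q —[ inpL a ]→ Q' → (i U , a , b) ∈ δ →
            δ ⊢ P ∥ Q —[ τ ]→ ν U (P' ∥ sub σI Q')
  t-bcomRO : ∀ {Γ U δ P Q P' Q'} {a : Γ ∋ i (o U)} {b : Γ ∋ o (o U)} →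
            δ ⊢ P —[ boutO b ]→ P' → δ ⊢ Q —[ inpL a ]→ Q' → (o U , a , b) ∈ δ →
            δ ⊢ P ∥ Q —[ τ ]→ ν U (P' ∥ sub σO Q')
  -- restriction: the label does not mention the restricted names (it is a weakening)
  t-res   : ∀ {Γ Δ T δ P} {μ : Label Γ Δ} {P'} →
            (_,νc {T = T} δ) ⊢ P —[ renL wk2 μ ]→ P' →
            δ ⊢ ν T P —[ μ ]→ ν T (ren (swapR Δ) P')
  t-openI : ∀ {Γ T δ P P'} {c : Γ ∋ o (i T)} →
            (_,νc {T = T} δ) ⊢ P —[ fout (wk2 c) (var zero) ]→ P' →
            δ ⊢ ν T P —[ boutI c ]→ P'
  t-openO : ∀ {Γ T δ P P'} {c : Γ ∋ o (o T)} →
            (_,νc {T = T} δ) ⊢ P —[ fout (wk2 c) (var (suc zero)) ]→ P' →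
            δ ⊢ ν T P —[ boutO c ]→ P'

data BoundOut {Γ : Ctx} : ∀ {Δ T} → Label Γ Δ → (Δ ++ Γ) ∋ T → Set where
  bo-I : ∀ {U} {a : Γ ∋ o (i U)} → BoundOut (boutI a) zero
  bo-O : ∀ {U} {a : Γ ∋ o (o U)} → BoundOut (boutO a) (suc zero)

module Submission where

-- In AWπ^E a name is only ever sent through the encoding a(c):[c̆ ↔ b], so no
-- process of AWπ^E performs a free output of a name; a bound output therefore
-- comes from one such encoding, opened at its own restriction.  What is left
-- after the extrusion is the wire [c̆ ↔ b], which mentions the companion c̆
-- but never c itself.  Parallel components and restrictions only see c
-- through weakenings, which keep it fresh.

open import Defs
open import Data.List using ([]; _∷_; _++_)
open import Data.Product using (Σ; _×_; _,_)
open import Relation.Binary.PropositionalEquality using (_≡_; refl)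
open import Relation.Nullary using (¬_)

-- Apartness of variables; unlike ≢ it relates variables of different types.
infix 4 _#_ _#ᵛ_
data _#_ : ∀ {Γ S T} → Γ ∋ S → Γ ∋ T → Set where
  zero#suc : ∀ {Γ S T} {y : Γ ∋ T} → zero {Γ} {S} # suc y
  suc#zero : ∀ {Γ S T} {x : Γ ∋ S} → suc x # zero {Γ} {T}
  suc#suc  : ∀ {Γ S T U} {x : Γ ∋ S} {y : Γ ∋ T} → x # y → suc {S = U} x # suc y

data _#ᵛ_ {Γ : Ctx} {S : Ty} (x : Γ ∋ S) : ∀ {T} → Val Γ T → Set where
  var# : ∀ {T} {y : Γ ∋ T} → x # y → x #ᵛ var y
  ⋆#   : x #ᵛ ⋆

#-irrefl : ∀ {Γ S} {x : Γ ∋ S} → ¬ x # x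
#-irrefl (suc#suc x#x) = #-irrefl x#x

∈fn-ren⁻¹ : ∀ {Γ Δ T} (ρ : Ren Γ Δ) (P : Proc Γ) {x : Δ ∋ T} →
            x ∈fn ren ρ P → Σ (Γ ∋ T) λ y → ρ y ≡ x × y ∈fn P
∈fn-ren⁻¹ ρ (P ∥ Q) (fn-parL x∈P) with ∈fn-ren⁻¹ ρ P x∈P
... | y , refl , y∈P = y , refl , fn-parL y∈P
∈fn-ren⁻¹ ρ (P ∥ Q) (fn-parR x∈Q) with ∈fn-ren⁻¹ ρ Q x∈Q
... | y , refl , y∈Q = y , refl , fn-parR y∈Q
∈fn-ren⁻¹ ρ (inp a P) fn-inpS = a , refl , fn-inpS
∈fn-ren⁻¹ ρ (inp a P) (fn-inpB x∈P) with ∈fn-ren⁻¹ (ext ρ) P x∈P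
... | suc y , refl , y∈P = y , refl , fn-inpB y∈P
∈fn-ren⁻¹ ρ (out a ⋆) fn-outS = a , refl , fn-outS
∈fn-ren⁻¹ ρ (out a (var y)) fn-outS = a , refl , fn-outS
∈fn-ren⁻¹ ρ (out a (var y)) fn-outO = y , refl , fn-outO
∈fn-ren⁻¹ ρ (ν S P) (fn-res x∈P) with ∈fn-ren⁻¹ (ext (ext ρ)) P x∈P
... | suc (suc y) , refl , y∈P = y , refl , fn-res y∈P
∈fn-ren⁻¹ ρ (rep a P) fn-repS = a , refl , fn-repS
∈fn-ren⁻¹ ρ (rep a P) (fn-repB x∈P) with ∈fn-ren⁻¹ (ext ρ) P x∈P
... | suc y , refl , y∈P = y , refl , fn-repB y∈P

∉fn-trOut : ∀ {Γ S T} {a : Γ ∋ o T} {v : Val Γ T} {x : Γ ∋ S} →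
            x # a → x #ᵛ v → ¬ x ∈fn trOut a v
∉fn-trOut {T = unit} x#a x#v       fn-outS = #-irrefl x#a
∉fn-trOut {T = unit} x#a (var# x#x) fn-outO = #-irrefl x#x
∉fn-trOut {T = i U} {v = var _} x#a x#v        (fn-res (fn-parL fn-outS)) = #-irrefl x#a
∉fn-trOut {T = i U} x#a (var# x#x) (fn-res (fn-parR fn-repS)) = #-irrefl x#x
∉fn-trOut {T = i U} {v = var _} x#a x#v        (fn-res (fn-parR (fn-repB x∈wire))) =
  ∉fn-trOut (suc#suc (suc#suc suc#zero)) (var# suc#zero) x∈wire
∉fn-trOut {T = o U} {v = var _} x#a x#v        (fn-res (fn-parL fn-outS)) = #-irrefl x#a
∉fn-trOut {T = o U} x#a (var# x#b) (fn-res (fn-parR (fn-repB x∈wire))) =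
  ∉fn-trOut (suc#suc (suc#suc (suc#suc x#b))) (var# suc#zero) x∈wire

AWE-fout-unit : ∀ {Γ T δ} {P : Proc Γ} {a : Γ ∋ o T} {v : Val Γ T} {P'} →
                AWE P → δ ⊢ P —[ fout a v ]→ P' → T ≡ unit
AWE-fout-unit (awe-par w _) (t-parL t) = AWE-fout-unit w t
AWE-fout-unit (awe-par _ w) (t-parR t) = AWE-fout-unit w t
AWE-fout-unit (awe-res w)   (t-res t)  = AWE-fout-unit w t
AWE-fout-unit (awe-out {T = unit}) t-out = refl
AWE-fout-unit {v = var _} (awe-out {T = i U} {v = var b}) (t-res (t-parL ()))
AWE-fout-unit (awe-out {T = i U} {v = var b}) (t-res (t-parR ()))
AWE-fout-unit {v = var _} (awe-out {T = o U} {v = var b}) (t-res (t-parL ()))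
AWE-fout-unit (awe-out {T = o U} {v = var b}) (t-res (t-parR ()))

trOut-bout-fresh : ∀ {Γ Δ T S δ} {a : Γ ∋ o T} {v : Val Γ T} {μ : Label Γ Δ}
                   {P' : Proc (Δ ++ Γ)} {c : (Δ ++ Γ) ∋ S} →
                   δ ⊢ trOut a v —[ μ ]→ P' → BoundOut μ c → ¬ c ∈fn P'
trOut-bout-fresh {T = unit} t-out ()
trOut-bout-fresh {T = i U} {v = var b} (t-openI (t-parL t-out)) bo-I (fn-parR c∈wire)
  with ∈fn-ren⁻¹ (wk* []) (rep (wk2 b) (trOut (suc (suc zero)) (var zero))) c∈wire
... | zero , refl , fn-repB c∈body = ∉fn-trOut (suc#suc zero#suc) (var# suc#zero) c∈body
trOut-bout-fresh {T = o U} {v = var b} (t-openO (t-parL t-out)) bo-O (fn-parR c∈wire)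
  with ∈fn-ren⁻¹ (wk* []) (rep zero (trOut (suc (wk2 b)) (var zero))) c∈wire
... | suc zero , refl , fn-repB c∈body =
  ∉fn-trOut (suc#suc (suc#suc zero#suc)) (var# suc#zero) c∈body
trOut-bout-fresh {T = i U} {v = var b} (t-res (t-parL ())) bo-I
trOut-bout-fresh {T = i U} {v = var b} (t-res (t-parL ())) bo-O
trOut-bout-fresh {T = i U} {v = var b} (t-res (t-parR ())) bo-I
trOut-bout-fresh {T = i U} {v = var b} (t-res (t-parR ())) bo-O
trOut-bout-fresh {T = i U} {v = var b} (t-openI (t-parR ())) bo-I
trOut-bout-fresh {T = i U} {v = var b} (t-openO (t-parL ())) bo-O
trOut-bout-fresh {T = i U} {v = var b} (t-openO (t-parR ())) bo-O
trOut-bout-fresh {T = o U} {v = var b} (t-res (t-parL ())) bo-I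
trOut-bout-fresh {T = o U} {v = var b} (t-res (t-parL ())) bo-O
trOut-bout-fresh {T = o U} {v = var b} (t-res (t-parR ())) bo-I
trOut-bout-fresh {T = o U} {v = var b} (t-res (t-parR ())) bo-O
trOut-bout-fresh {T = o U} {v = var b} (t-openO (t-parR ())) bo-O
trOut-bout-fresh {T = o U} {v = var b} (t-openI (t-parL ())) bo-I
trOut-bout-fresh {T = o U} {v = var b} (t-openI (t-parR ())) bo-I

BoundOut-∉fn-wk* : ∀ {Γ Δ S} {μ : Label Γ Δ} {c : (Δ ++ Γ) ∋ S} (Q : Proc Γ) →
                   BoundOut μ c → ¬ c ∈fn ren (wk* Δ) Q
BoundOut-∉fn-wk* Q bo-I c∈Q with ∈fn-ren⁻¹ (wk* _) Q c∈Q
... | _ , () , _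
BoundOut-∉fn-wk* Q bo-O c∈Q with ∈fn-ren⁻¹ (wk* _) Q c∈Q
... | _ , () , _

BoundOut-under-ν : ∀ {Γ Δ S T} {μ : Label Γ Δ} {c : (Δ ++ Γ) ∋ S}
                  (y : (Δ ++ (i T ∷ o T ∷ Γ)) ∋ S) →
                  BoundOut μ c → swapR Δ y ≡ suc (suc c) → BoundOut (renL wk2 μ) y
BoundOut-under-ν zero       bo-I refl = bo-I
BoundOut-under-ν (suc zero) bo-O refl = bo-O
BoundOut-under-ν (suc (suc zero)) bo-I ()
BoundOut-under-ν (suc (suc (suc (suc y)))) bo-I ()
BoundOut-under-ν (suc (suc (suc (suc y)))) bo-O ()

lemma5p3 : ∀ {Γ Δ T} {δ : Conn Γ} {P : Proc Γ} {μ : Label Γ Δ} {P' : Proc (Δ ++ Γ)} {c : (Δ ++ Γ) ∋ T} →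
    AWE P → δ ⊢ P —[ μ ]→ P' → BoundOut μ c → ¬ (c ∈fn P')
lemma5p3 (awe-inp _) t-inp ()
lemma5p3 (awe-rep _) t-rep ()
lemma5p3 awe-out t bo = trOut-bout-fresh t bo
lemma5p3 (awe-par w _) (t-parL t) bo (fn-parL c∈P') = lemma5p3 w t bo c∈P'
lemma5p3 (awe-par _ w) (t-parR t) bo (fn-parR c∈Q') = lemma5p3 w t bo c∈Q'
lemma5p3 {P = _ ∥ Q} _ (t-parL _) bo (fn-parR c∈Q) = BoundOut-∉fn-wk* Q bo c∈Q
lemma5p3 {P = P ∥ _} _ (t-parR _) bo (fn-parL c∈P) = BoundOut-∉fn-wk* P bo c∈P
lemma5p3 (awe-res w) (t-res {Δ = Δ} {P' = P'} t) bo (fn-res c∈P') with ∈fn-ren⁻¹ (swapR Δ) P' c∈P'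
... | y , swap-y≡c , y∈P' = lemma5p3 w t (BoundOut-under-ν y bo swap-y≡c) y∈P'
lemma5p3 (awe-res w) (t-openI t) _ with AWE-fout-unit w t
... | ()
lemma5p3 (awe-res w) (t-openO t) _ with AWE-fout-unit w t
... | ()
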